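{- Let $t$ be an indeterminate and work in $\mathbb{Q}(t)$. For positive integers $i,j$ define \[ L_{i,j}=\frac{\prod_{k=1}^j\bigl((2j-1)^2t^2-(2k)^2 \bigr)}{\prod_{k=1}^j\bigl((2i-1)^2t^2-(2k)^2 \bigr)}\cdot \frac{(i+j-2)!}{(i-j)!\,(2j-2)!}\quad (j\le i),\qquad L_{i,j}=0\quad (j>i), \] and \[ \widetilde L_{i,j}=\frac{\prod_{k=1}^{i-1}\bigl((2j-1)^2t^2-(2k)^2\bigr)}{\prod_{k=1}^{i-1}\bigl((2i-1)^2t^2-(2k)^2\bigr)}\cdot \frac{(-1)^{i+j}(2i-2)!\,(2j-1)}{(i+j-1)!\,(i-j)!}\quad (j\le i),\qquad \widetilde L_{i,j}=0\quad (j>i). \] Then for every positive integer $s$, the matrix $(\widetilde L_{i,j})_{1\le i,j\le s}$ is the inverse of $(L_{i,j})_{1\le i,j\le s}$; that is, $\sum_{j=k}^{i}L_{i,j}\widetilde L_{j,k}=\delta_{i,k}$ for all $1\le k\le i$.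
   Context: Empty products equal $1$; $\delta_{i,k}$ is the Kronecker delta. The identities are identities of rational functions in $t$. -}

module Defs where

open import Data.Nat as ℕ using (ℕ; zero; suc; _≤?_; _!)
open import Data.Integer using (+_)
open import Data.Rational using (ℚ; 0ℚ; 1ℚ; _+_; _*_; _-_; -_; 1/_; _/_; ≢-nonZero)
open import Data.Rational.Properties using (_≟_)
open import Relation.Nullary using (yes; no)

nq : ℕ → ℚ
nq n = (+ n) / 1

-- total inverse: inv 0 = 0 (only ever used under the hypothesis that
-- the relevant denominators are nonzero)
inv : ℚ → ℚ
inv p with p ≟ 0ℚ
... | yes _ = 0ℚ
... | no p≢0 = 1/_ p {{≢-nonZero p≢0}}

prod1 : ℕ → (ℕ → ℚ) → ℚ
prod1 zero    f = 1ℚ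
prod1 (suc n) f = prod1 n f * f (suc n)

sum1 : ℕ → (ℕ → ℚ) → ℚ
sum1 zero    f = 0ℚ
sum1 (suc n) f = sum1 n f + f (suc n)

sgn : ℕ → ℚ
sgn zero    = 1ℚ
sgn (suc n) = - sgn n

δ : ℕ → ℕ → ℚ
δ i k with i ℕ.≟ k
... | yes _ = 1ℚ
... | no _  = 0ℚ

fac : ℚ → ℕ → ℕ → ℚ
fac t a b = nq ((2 ℕ.* a ℕ.∸ 1) ℕ.^ 2) * (t * t) - nq ((2 ℕ.* b) ℕ.^ 2)

-- L_{i,j}(t), evaluated at t ∈ ℚ
L : ℚ → ℕ → ℕ → ℚ
L t i j with j ≤? i
... | no _  = 0ℚ
... | yes _ =
  (prod1 j (fac t j) * inv (prod1 j (fac t i)))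
  * (nq ((i ℕ.+ j ℕ.∸ 2) !) * inv (nq ((i ℕ.∸ j) !) * nq ((2 ℕ.* j ℕ.∸ 2) !)))

Lt : ℚ → ℕ → ℕ → ℚ
Lt t i j with j ≤? i
... | no _  = 0ℚ
... | yes _ =
  (prod1 (i ℕ.∸ 1) (fac t j) * inv (prod1 (i ℕ.∸ 1) (fac t i)))
  * ((sgn (i ℕ.+ j) * nq ((2 ℕ.* i ℕ.∸ 2) !) * nq (2 ℕ.* j ℕ.∸ 1))
     * inv (nq ((i ℕ.+ j ℕ.∸ 1) !) * nq ((i ℕ.∸ j) !)))

{-# OPTIONS --safe #-}
-- For k < i the sum telescopes.  Write f(a,b) = (2a-1)²t² - (2b)², P_a(n) = ∏_{l ≤ n} f(a,l),
-- ρ(x,y) = y(y-1) - x(x-1) and c_n = (-1)^{n+k} (2k-1) (i+n-2)! / ((i-n)! (n+k-1)! (n-k)!).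
-- Then L_{i,n} L̃_{n,k} = f(n,n) P_k(n-1) c_n / P_i(n), and Gosper's algorithm finds the antidifference
--   ρ(i,k) · Σ_{j ≤ n} L_{i,j} L̃_{j,k} = P_k(n) c_n ρ(i,n) / P_i(n)        (k ≤ n ≤ i).
-- Its induction step uses only the rational ratio c_{n+1}/c_n and the polynomial identity
--   ρ(k,n) f(i,n) + ρ(i,k) f(n,n) = f(k,n) ρ(i,n).
-- At n = i the right-hand side vanishes because ρ(i,i) = 0, while ρ(i,k) ≠ 0.  For i < k every
-- L̃_{j,k} in the sum is 0, and for i = k only the diagonal term L_{k,k} L̃_{k,k} = 1 survives.
module Submission where

open import Defs
open import Data.Nat using (ℕ; _≤_)
open import Data.Rational using (ℚ; 0ℚ; _*_)
open import Relation.Binary.PropositionalEquality using (_≡_; _≢_)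

import Data.Integer as ℤ
import Data.Integer.Properties as ℤ
open import Data.Integer using (+_)
import Data.Nat as ℕ
import Data.Nat.Properties as ℕ
open import Data.Nat using (zero; suc; _∸_; _<_; _≤?_; _!; s≤s; z≤n)
import Data.Nat.Coprimality as Coprimality
open import Data.Rational using (1ℚ; _+_; _-_; -_; _/_; mkℚ; ≢-nonZero)
import Data.Rational.Properties as ℚ
open import Level using (0ℓ)
open import Relation.Binary.PropositionalEquality
  using (refl; sym; trans; cong; cong₂; subst; module ≡-Reasoning)
open import Data.List using (_∷_; [])
open import Data.Sum using (inj₁; inj₂)
open import Relation.Binary.Definitions using (Tri; tri<; tri≈; tri>)
open import Relation.Nullary using (Dec; yes; no; contradiction)
open import Relation.Nullary.Decidable using (dec⇒maybe)
open import Tactic.RingSolver using (solve-∀; solve)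
open import Tactic.RingSolver.Core.AlmostCommutativeRing
  using (AlmostCommutativeRing; fromCommutativeRing)

open ≡-Reasoning

ℚ-ring : AlmostCommutativeRing 0ℓ 0ℓ
ℚ-ring = fromCommutativeRing ℚ.+-*-commutativeRing (λ x → dec⇒maybe (0ℚ ℚ.≟ x))

inv-inverseˡ : ∀ {p} → p ≢ 0ℚ → inv p * p ≡ 1ℚ
inv-inverseˡ {p} p≢0 with p ℚ.≟ 0ℚ
... | yes p≡0 = contradiction p≡0 p≢0
... | no p≢0′ = ℚ.*-inverseˡ p {{≢-nonZero p≢0′}}

inv-inverseʳ : ∀ {p} → p ≢ 0ℚ → p * inv p ≡ 1ℚ
inv-inverseʳ {p} p≢0 = trans (ℚ.*-comm p (inv p)) (inv-inverseˡ p≢0)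

*-cancelˡ-≡0 : ∀ {p q} → p ≢ 0ℚ → p * q ≡ 0ℚ → q ≡ 0ℚ
*-cancelˡ-≡0 {p} {q} p≢0 pq≡0 = begin
  q                ≡⟨ sym (ℚ.*-identityˡ q) ⟩
  1ℚ * q           ≡⟨ cong (_* q) (sym (inv-inverseˡ p≢0)) ⟩
  inv p * p * q    ≡⟨ ℚ.*-assoc (inv p) p q ⟩
  inv p * (p * q)  ≡⟨ cong (inv p *_) pq≡0 ⟩
  inv p * 0ℚ       ≡⟨ ℚ.*-zeroʳ (inv p) ⟩
  0ℚ               ∎

*-≢0 : ∀ {p q} → p ≢ 0ℚ → q ≢ 0ℚ → p * q ≢ 0ℚ
*-≢0 p≢0 q≢0 pq≡0 = q≢0 (*-cancelˡ-≡0 p≢0 pq≡0)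

-‿≢0 : ∀ {p} → p ≢ 0ℚ → - p ≢ 0ℚ
-‿≢0 p≢0 -p≡0 = p≢0 (ℚ.neg-injective -p≡0)

*-inverseʳ-cancel : ∀ p {q} → q ≢ 0ℚ → p * (q * inv q) ≡ p
*-inverseʳ-cancel p q≢0 = trans (cong (p *_) (inv-inverseʳ q≢0)) (ℚ.*-identityʳ p)

inv-unique : ∀ p {q} → p * q ≡ 1ℚ → inv p ≡ q
inv-unique p {q} pq≡1 = begin
  inv p              ≡⟨ sym (ℚ.*-identityʳ (inv p)) ⟩
  inv p * 1ℚ         ≡⟨ cong (inv p *_) (sym pq≡1) ⟩
  inv p * (p * q)    ≡⟨ sym (ℚ.*-assoc (inv p) p q) ⟩
  inv p * p * q      ≡⟨ cong (_* q) (inv-inverseˡ p≢0) ⟩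
  1ℚ * q             ≡⟨ ℚ.*-identityˡ q ⟩
  q                  ∎
  where
  p≢0 : p ≢ 0ℚ
  p≢0 refl = ℚ.1≢0 (trans (sym pq≡1) (ℚ.*-zeroˡ q))

inv-distrib-* : ∀ p q → inv (p * q) ≡ inv p * inv q
inv-distrib-* p q = by-cases (p ℚ.≟ 0ℚ) (q ℚ.≟ 0ℚ)
  where
  interchange : ∀ a b c d → a * b * (c * d) ≡ a * c * (b * d)
  interchange = solve-∀ ℚ-ring

  by-cases : Dec (p ≡ 0ℚ) → Dec (q ≡ 0ℚ) → inv (p * q) ≡ inv p * inv q
  by-cases (yes refl) _ = trans (cong inv (ℚ.*-zeroˡ q)) (sym (ℚ.*-zeroˡ (inv q)))
  by-cases (no _) (yes refl) = trans (cong inv (ℚ.*-zeroʳ p)) (sym (ℚ.*-zeroʳ (inv p)))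
  by-cases (no p≢0) (no q≢0) = inv-unique (p * q) (begin
    p * q * (inv p * inv q)  ≡⟨ interchange p q (inv p) (inv q) ⟩
    p * inv p * (q * inv q)  ≡⟨ cong₂ _*_ (inv-inverseʳ p≢0) (inv-inverseʳ q≢0) ⟩
    1ℚ * 1ℚ                  ≡⟨ ℚ.*-identityˡ 1ℚ ⟩
    1ℚ                       ∎)

nq≡mkℚ : ∀ n → nq n ≡ mkℚ (+ n) 0 (Coprimality.sym (Coprimality.1-coprimeTo n))
nq≡mkℚ n = ℚ.↥p/↧p≡p _

nq-+ : ∀ m n → nq (m ℕ.+ n) ≡ nq m + nq n
nq-+ m n rewrite nq≡mkℚ m | nq≡mkℚ n =
  cong (_/ 1) (cong₂ ℤ._+_ (sym (ℤ.*-identityʳ (+ m))) (sym (ℤ.*-identityʳ (+ n))))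

nq-* : ∀ m n → nq (m ℕ.* n) ≡ nq m * nq n
nq-* m n rewrite nq≡mkℚ m | nq≡mkℚ n = cong (_/ 1) (ℤ.pos-* m n)

nq-∸ : ∀ {m n} → n ≤ m → nq (m ∸ n) ≡ nq m - nq n
nq-∸ {m} {n} n≤m = begin
  nq (m ∸ n)                  ≡⟨ add-sub (nq (m ∸ n)) (nq n) ⟩
  nq (m ∸ n) + nq n - nq n    ≡⟨ cong (_- nq n) (sym (nq-+ (m ∸ n) n)) ⟩
  nq (m ∸ n ℕ.+ n) - nq n     ≡⟨ cong (λ x → nq x - nq n) (ℕ.m∸n+n≡m n≤m) ⟩
  nq m - nq n                 ∎
  where
  add-sub : ∀ x y → x ≡ x + y - y
  add-sub = solve-∀ ℚ-ring

nq-suc : ∀ n → nq (suc n) ≡ nq n + 1ℚ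
nq-suc n = trans (cong nq (ℕ.+-comm 1 n)) (nq-+ n 1)

nq-≢0 : ∀ {n} → 1 ≤ n → nq n ≢ 0ℚ
nq-≢0 {suc n} _ eq with trans (sym (nq≡mkℚ (suc n))) eq
... | ()

nq-!≢0 : ∀ n → nq (n !) ≢ 0ℚ
nq-!≢0 zero = nq-≢0 {1} (s≤s z≤n)
nq-!≢0 (suc n) eq =
  *-≢0 (nq-≢0 {suc n} (s≤s z≤n)) (nq-!≢0 n) (trans (sym (nq-* (suc n) (n !))) eq)

nq-!-step : ∀ {n x} → n ≡ suc x → nq (n !) ≡ nq n * nq (x !)
nq-!-step {x = x} refl = nq-* (suc x) (x !)

inv-nq-!-step : ∀ {n x} → n ≡ suc x → inv (nq (n !)) * nq n ≡ inv (nq (x !))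
inv-nq-!-step {x = x} refl = begin
  inv (nq (suc x !)) * nq (suc x)
    ≡⟨ cong (λ y → inv y * nq (suc x)) (nq-!-step {x = x} refl) ⟩
  inv (nq (suc x) * nq (x !)) * nq (suc x)
    ≡⟨ cong (_* nq (suc x)) (inv-distrib-* (nq (suc x)) (nq (x !))) ⟩
  inv (nq (suc x)) * inv (nq (x !)) * nq (suc x)
    ≡⟨ swap (inv (nq (suc x))) (inv (nq (x !))) (nq (suc x)) ⟩
  inv (nq (x !)) * (inv (nq (suc x)) * nq (suc x))
    ≡⟨ cong (inv (nq (x !)) *_) (inv-inverseˡ (nq-≢0 {suc x} (s≤s z≤n))) ⟩
  inv (nq (x !)) * 1ℚ
    ≡⟨ ℚ.*-identityʳ (inv (nq (x !))) ⟩
  inv (nq (x !)) ∎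
  where
  swap : ∀ a b c → a * b * c ≡ b * (a * c)
  swap = solve-∀ ℚ-ring

nq-square : ∀ n → nq (n ℕ.^ 2) ≡ nq n * nq n
nq-square n = trans (nq-* n (n ℕ.* 1)) (cong (nq n *_) (cong nq (ℕ.*-identityʳ n)))

sum1-zero : ∀ n f → (∀ j → j ≤ n → f j ≡ 0ℚ) → sum1 n f ≡ 0ℚ
sum1-zero zero    f _      = refl
sum1-zero (suc n) f f≡0 = begin
  sum1 n f + f (suc n)
    ≡⟨ cong₂ _+_ (sum1-zero n f (λ j j≤n → f≡0 j (ℕ.m≤n⇒m≤1+n j≤n))) (f≡0 (suc n) ℕ.≤-refl) ⟩
  0ℚ + 0ℚ
    ≡⟨ ℚ.+-identityˡ 0ℚ ⟩
  0ℚ ∎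

sum1-tail : ∀ {n} s f → n ≤ s → (∀ j → n < j → f j ≡ 0ℚ) → sum1 s f ≡ sum1 n f
sum1-tail zero    f z≤n     _ = refl
sum1-tail {n} (suc s) f n≤1+s f≡0 with ℕ.m≤n⇒m<n∨m≡n n≤1+s
... | inj₂ refl = refl
... | inj₁ n<1+s = begin
  sum1 s f + f (suc s)
    ≡⟨ cong₂ _+_ (sum1-tail s f (ℕ.≤-pred n<1+s) f≡0) (f≡0 (suc s) n<1+s) ⟩
  sum1 n f + 0ℚ
    ≡⟨ ℚ.+-identityʳ (sum1 n f) ⟩
  sum1 n f ∎

L-upper≡0 : ∀ {t i j} → i < j → L t i j ≡ 0ℚ
L-upper≡0 {t} {i} {j} i<j with j ≤? i
... | yes j≤i = contradiction j≤i (ℕ.<⇒≱ i<j)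
... | no _    = refl

Lt-upper≡0 : ∀ {t i j} → i < j → Lt t i j ≡ 0ℚ
Lt-upper≡0 {t} {i} {j} i<j with j ≤? i
... | yes j≤i = contradiction j≤i (ℕ.<⇒≱ i<j)
... | no _    = refl

L-lower : ∀ {t i j} → j ≤ i → L t i j ≡
  prod1 j (fac t j) * inv (prod1 j (fac t i))
  * (nq ((i ℕ.+ j ∸ 2) !) * inv (nq ((i ∸ j) !) * nq ((2 ℕ.* j ∸ 2) !)))
L-lower {t} {i} {j} j≤i with j ≤? i
... | yes _   = refl
... | no j≰i = contradiction j≤i j≰i

Lt-lower : ∀ {t i j} → j ≤ i → Lt t i j ≡
  prod1 (i ∸ 1) (fac t j) * inv (prod1 (i ∸ 1) (fac t i))
  * (sgn (i ℕ.+ j) * nq ((2 ℕ.* i ∸ 2) !) * nq (2 ℕ.* j ∸ 1)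
     * inv (nq ((i ℕ.+ j ∸ 1) !) * nq ((i ∸ j) !)))
Lt-lower {t} {i} {j} j≤i with j ≤? i
... | yes _   = refl
... | no j≰i = contradiction j≤i j≰i

sgn-even : ∀ n → sgn (n ℕ.+ n) ≡ 1ℚ
sgn-even zero    = refl
sgn-even (suc n) = begin
  sgn (suc (n ℕ.+ suc n))  ≡⟨ cong (λ x → sgn (suc x)) (ℕ.+-suc n n) ⟩
  - (- sgn (n ℕ.+ n))      ≡⟨ neg-involutive (sgn (n ℕ.+ n)) ⟩
  sgn (n ℕ.+ n)            ≡⟨ sgn-even n ⟩
  1ℚ                       ∎
  where
  neg-involutive : ∀ x → - (- x) ≡ x
  neg-involutive = solve-∀ ℚ-ring

L-diagonal : ∀ {t k} → prod1 k (fac t k) ≢ 0ℚ → L t k k ≡ 1ℚ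
L-diagonal {t} {k} P≢0 = begin
  L t k k
    ≡⟨ L-lower {t} {k} {k} ℕ.≤-refl ⟩
  P * inv P * (nq ((k ℕ.+ k ∸ 2) !) * inv (nq ((k ∸ k) !) * nq ((2 ℕ.* k ∸ 2) !)))
    ≡⟨ cong₂ (λ a b → P * inv P * (G * inv (nq (a !) * nq ((b ∸ 2) !))))
             (ℕ.n∸n≡0 k) (cong (k ℕ.+_) (ℕ.+-identityʳ k)) ⟩
  P * inv P * (G * inv (1ℚ * G))
    ≡⟨ cong (λ x → P * inv P * (G * inv x)) (ℚ.*-identityˡ G) ⟩
  P * inv P * (G * inv G)
    ≡⟨ cong₂ _*_ (inv-inverseʳ P≢0) (inv-inverseʳ (nq-!≢0 (k ℕ.+ k ∸ 2))) ⟩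
  1ℚ * 1ℚ
    ≡⟨ ℚ.*-identityˡ 1ℚ ⟩
  1ℚ ∎
  where
  P G : ℚ
  P = prod1 k (fac t k)
  G = nq ((k ℕ.+ k ∸ 2) !)

Lt-diagonal : ∀ {t} k′ → prod1 k′ (fac t (suc k′)) ≢ 0ℚ → Lt t (suc k′) (suc k′) ≡ 1ℚ
Lt-diagonal {t} k′ Q≢0 = begin
  Lt t k k
    ≡⟨ Lt-lower {t} {k} {k} ℕ.≤-refl ⟩
  Q * inv Q * (sgn (k ℕ.+ k) * nq ((2 ℕ.* k ∸ 2) !) * nq (2 ℕ.* k ∸ 1) * inv (B * Z))
    ≡⟨ cong₂ (λ a b → Q * inv Q * (a * nq ((b ∸ 1) !) * nq b * inv (B * Z))) (sgn-even k) 2k-1≡1+x ⟩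
  Q * inv Q * (1ℚ * nq (x !) * nq (suc x) * inv (B * Z))
    ≡⟨ cong₂ (λ a b → Q * inv Q * (1ℚ * nq (x !) * nq (suc x) * inv (nq (a !) * nq (b !))))
             (ℕ.+-suc k′ k′) (ℕ.n∸n≡0 k) ⟩
  Q * inv Q * (1ℚ * nq (x !) * nq (suc x) * inv (nq (suc x !) * 1ℚ))
    ≡⟨ cong₂ _*_ (inv-inverseʳ Q≢0) coefficient ⟩
  1ℚ * 1ℚ
    ≡⟨ ℚ.*-identityˡ 1ℚ ⟩
  1ℚ ∎
  where
  k x : ℕ
  k = suc k′
  x = k′ ℕ.+ k′
  Q B Z : ℚ
  Q = prod1 k′ (fac t k)
  B = nq ((k ℕ.+ k ∸ 1) !)
  Z = nq ((k ∸ k) !)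
  2k-1≡1+x : 2 ℕ.* k ∸ 1 ≡ suc x
  2k-1≡1+x = trans (ℕ.+-suc k′ (k′ ℕ.+ 0)) (cong (λ y → suc (k′ ℕ.+ y)) (ℕ.+-identityʳ k′))
  reorder : ∀ a b → 1ℚ * a * b ≡ b * a
  reorder = solve-∀ ℚ-ring
  coefficient : 1ℚ * nq (x !) * nq (suc x) * inv (nq (suc x !) * 1ℚ) ≡ 1ℚ
  coefficient = begin
    1ℚ * nq (x !) * nq (suc x) * inv (nq (suc x !) * 1ℚ)
      ≡⟨ cong₂ (λ a b → a * inv b)
               (trans (reorder (nq (x !)) (nq (suc x))) (sym (nq-* (suc x) (x !))))
               (ℚ.*-identityʳ (nq (suc x !))) ⟩
    nq (suc x !) * inv (nq (suc x !))
      ≡⟨ inv-inverseʳ (nq-!≢0 (suc x)) ⟩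
    1ℚ ∎

δ-refl : ∀ i → δ i i ≡ 1ℚ
δ-refl i with i ℕ.≟ i
... | yes _   = refl
... | no i≢i = contradiction refl i≢i

δ-≢ : ∀ {i k} → i ≢ k → δ i k ≡ 0ℚ
δ-≢ {i} {k} i≢k with i ℕ.≟ k
... | yes i≡k = contradiction i≡k i≢k
... | no _    = refl

fac-polynomial : ∀ t {a} b → 1 ≤ a →
        fac t a b ≡ (nq 2 * nq a - 1ℚ) * (nq 2 * nq a - 1ℚ) * (t * t) - nq 2 * nq b * (nq 2 * nq b)
fac-polynomial t {a} b 1≤a = cong₂ (λ x y → x * (t * t) - y)
  (trans (nq-square (2 ℕ.* a ∸ 1)) (cong (λ x → x * x) odd))
  (trans (nq-square (2 ℕ.* b)) (cong (λ x → x * x) (nq-* 2 b)))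
  where
  odd : nq (2 ℕ.* a ∸ 1) ≡ nq 2 * nq a - 1ℚ
  odd = trans (nq-∸ (ℕ.≤-trans 1≤a (ℕ.m≤n*m a 2))) (cong (_- 1ℚ) (nq-* 2 a))

ρ : ℚ → ℚ → ℚ
ρ x y = (y - x) * (y + x - 1ℚ)

gosper-certificate : ∀ u I K N →
  let φ : ℚ → ℚ → ℚ
      φ A B = (nq 2 * A - 1ℚ) * (nq 2 * A - 1ℚ) * u - nq 2 * B * (nq 2 * B)
  in (N - K) * (N + K - 1ℚ) * φ I N + (K - I) * (K + I - 1ℚ) * φ N N
     ≡ φ K N * ((N - I) * (N + I - 1ℚ))
gosper-certificate = solve-∀ ℚ-ring

module ProductEntry (t : ℚ) (fac≢0 : ∀ a b → 1 ≤ a → 1 ≤ b → fac t a b ≢ 0ℚ) (i k′ : ℕ) where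

  k : ℕ
  k = suc k′

  I K : ℚ
  I = nq i
  K = nq k

  P : ℕ → ℕ → ℚ
  P a n = prod1 n (fac t a)

  C : ℕ → ℚ
  C n = sgn (n ℕ.+ k) * nq (2 ℕ.* k ∸ 1) * nq ((i ℕ.+ n ∸ 2) !)
      * inv (nq ((i ∸ n) !)) * inv (nq ((n ℕ.+ k ∸ 1) !)) * inv (nq ((n ∸ k) !))

  F T : ℕ → ℚ
  F n = L t i n * Lt t n k
  T n = sum1 n F

  D : ℚ
  D = ρ I K

  E X : ℕ → ℚ
  E n = ρ I (nq n)
  X n = ρ K (nq n)

  Telescoped : ℕ → Set
  Telescoped n = P i n * (D * T n) ≡ P k n * (C n * E n)

  P≢0 : ∀ {a} n → 1 ≤ a → P a n ≢ 0ℚ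
  P≢0 zero    1≤a ()
  P≢0 (suc n) 1≤a = *-≢0 (P≢0 n 1≤a) (fac≢0 _ (suc n) 1≤a (s≤s z≤n))

  D≢0 : k < i → D ≢ 0ℚ
  D≢0 k<i = *-≢0 (subst (_≢ 0ℚ) K-I (-‿≢0 (nq-≢0 (ℕ.m<n⇒0<n∸m k<i))))
                 (subst (_≢ 0ℚ) K+I-1 (nq-≢0 (ℕ.≤-trans 1≤i (ℕ.m≤n+m i k′))))
    where
    1≤i : 1 ≤ i
    1≤i = ℕ.≤-trans (s≤s z≤n) (ℕ.<⇒≤ k<i)
    neg-sub : ∀ x y → - (x - y) ≡ y - x
    neg-sub = solve-∀ ℚ-ring
    shift : ∀ x y → x + y ≡ x + 1ℚ + y - 1ℚ
    shift = solve-∀ ℚ-ring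
    K-I : - nq (i ∸ k) ≡ K - I
    K-I = trans (cong -_ (nq-∸ (ℕ.<⇒≤ k<i))) (neg-sub I K)
    K+I-1 : nq (k′ ℕ.+ i) ≡ K + I - 1ℚ
    K+I-1 = trans (nq-+ k′ i) (trans (shift (nq k′) I) (cong (λ x → x + I - 1ℚ) (sym (nq-suc k′))))

  n<k⇒T[n]≡0 : ∀ n → n < k → T n ≡ 0ℚ
  n<k⇒T[n]≡0 n n<k = sum1-zero n F λ j j≤n →
    trans (cong (L t i j *_) (Lt-upper≡0 (ℕ.≤-<-trans j≤n n<k))) (ℚ.*-zeroʳ (L t i j))

  summand : ∀ m → k ≤ suc m → suc m ≤ i →
            P i (suc m) * F (suc m) ≡ fac t (suc m) (suc m) * P k m * C (suc m)
  summand m k≤n n≤i = begin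
    Pi * (L t i n * Lt t n k)
      ≡⟨ cong (Pi *_) (cong₂ _*_ (L-lower n≤i) (Lt-lower k≤n)) ⟩
    Pi * (Pn * f * inv Pi * (G * inv (A * A₂)) * (Pk * inv Pn * (s * A₂ * c * inv (B * Z))))
      ≡⟨ cong₂ (λ x y → Pi * (Pn * f * inv Pi * (G * x) * (Pk * inv Pn * (s * A₂ * c * y))))
               (inv-distrib-* A A₂) (inv-distrib-* B Z) ⟩
    Pi * (Pn * f * inv Pi * (G * (inv A * inv A₂)) * (Pk * inv Pn * (s * A₂ * c * (inv B * inv Z))))
      ≡⟨ rearrange Pi (inv Pi) Pn (inv Pn) f G (inv A) A₂ (inv A₂) Pk s c (inv B) (inv Z) ⟩
    f * Pk * C n * (Pi * inv Pi) * (Pn * inv Pn) * (A₂ * inv A₂)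
      ≡⟨ *-inverseʳ-cancel _ (nq-!≢0 (2 ℕ.* n ∸ 2)) ⟩
    f * Pk * C n * (Pi * inv Pi) * (Pn * inv Pn)
      ≡⟨ *-inverseʳ-cancel _ (P≢0 {n} m (s≤s z≤n)) ⟩
    f * Pk * C n * (Pi * inv Pi)
      ≡⟨ *-inverseʳ-cancel _ (P≢0 {i} n (ℕ.≤-trans (s≤s z≤n) n≤i)) ⟩
    f * Pk * C n ∎
    where
    n : ℕ
    n = suc m
    Pi Pn Pk f G A A₂ s c B Z : ℚ
    Pi = P i n
    Pn = P n m
    Pk = P k m
    f  = fac t n n
    G  = nq ((i ℕ.+ n ∸ 2) !)
    A  = nq ((i ∸ n) !)
    A₂ = nq ((2 ℕ.* n ∸ 2) !)
    s  = sgn (n ℕ.+ k)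
    c  = nq (2 ℕ.* k ∸ 1)
    B  = nq ((n ℕ.+ k ∸ 1) !)
    Z  = nq ((n ∸ k) !)
    rearrange : ∀ Pi ιPi Pn ιPn f G ιA A₂ ιA₂ Pk s c ιB ιZ →
      Pi * (Pn * f * ιPi * (G * (ιA * ιA₂)) * (Pk * ιPn * (s * A₂ * c * (ιB * ιZ))))
      ≡ f * Pk * (s * c * G * ιA * ιB * ιZ) * (Pi * ιPi) * (Pn * ιPn) * (A₂ * ιA₂)
    rearrange = solve-∀ ℚ-ring

  C-recurrence : ∀ m → k ≤ m → suc m ≤ i → C m * E m ≡ C (suc m) * X (suc m)
  C-recurrence m k≤m n≤i =
    ratio-identity (sgn (m ℕ.+ k)) (nq (2 ℕ.* k ∸ 1)) (nq ((i ℕ.+ m ∸ 2) !)) (inv (nq ((i ∸ m) !)))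
                   (inv (nq ((m ℕ.+ k) !))) (inv (nq ((suc m ∸ k) !))) I M K
                   G-step A-step B-step Z-step (nq-suc m)
    where
    M : ℚ
    M = nq m
    -- Matching on refl eliminates the primed variables, leaving a ring identity.
    ratio-identity : ∀ s c G ιA ιB′ ιZ′ I M K {G′ ιA′ ιB ιZ M′} →
      G′ ≡ (I + M - 1ℚ) * G → ιA * (I - M) ≡ ιA′ →
      ιB′ * (M + K) ≡ ιB → ιZ′ * (M + 1ℚ - K) ≡ ιZ → M′ ≡ M + 1ℚ →
      s * c * G * ιA * ιB * ιZ * ((M - I) * (M + I - 1ℚ))
      ≡ - s * c * G′ * ιA′ * ιB′ * ιZ′ * ((M′ - K) * (M′ + K - 1ℚ))
    ratio-identity s c G ιA ιB′ ιZ′ I M K refl refl refl refl refl =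
      solve (s ∷ c ∷ G ∷ ιA ∷ ιB′ ∷ ιZ′ ∷ I ∷ M ∷ K ∷ []) ℚ-ring
    1≤m : 1 ≤ m
    1≤m = ℕ.≤-trans (s≤s z≤n) k≤m
    m≤i : m ≤ i
    m≤i = ℕ.≤-trans (ℕ.n≤1+n m) n≤i
    G-step : nq ((i ℕ.+ suc m ∸ 2) !) ≡ (I + M - 1ℚ) * nq ((i ℕ.+ m ∸ 2) !)
    G-step = begin
      nq ((i ℕ.+ suc m ∸ 2) !)
        ≡⟨ cong (λ x → nq ((x ∸ 2) !)) (ℕ.+-suc i m) ⟩
      nq ((i ℕ.+ m ∸ 1) !)
        ≡⟨ nq-!-step (ℕ.+-∸-assoc 1 (ℕ.+-mono-≤ (ℕ.≤-trans 1≤m m≤i) 1≤m)) ⟩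
      nq (i ℕ.+ m ∸ 1) * nq ((i ℕ.+ m ∸ 2) !)
        ≡⟨ cong (_* nq ((i ℕ.+ m ∸ 2) !))
                (trans (nq-∸ (ℕ.≤-trans 1≤m (ℕ.m≤n+m m i))) (cong (_- 1ℚ) (nq-+ i m))) ⟩
      (I + M - 1ℚ) * nq ((i ℕ.+ m ∸ 2) !) ∎
    A-step : inv (nq ((i ∸ m) !)) * (I - M) ≡ inv (nq ((i ∸ suc m) !))
    A-step = trans (cong (inv (nq ((i ∸ m) !)) *_) (sym (nq-∸ m≤i)))
                   (inv-nq-!-step (ℕ.+-∸-assoc 1 n≤i))
    B-step : inv (nq ((m ℕ.+ k) !)) * (M + K) ≡ inv (nq ((m ℕ.+ k ∸ 1) !))
    B-step = trans (cong (inv (nq ((m ℕ.+ k) !)) *_) (sym (nq-+ m k)))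
                   (inv-nq-!-step (ℕ.+-∸-assoc 1 (ℕ.≤-trans 1≤m (ℕ.m≤m+n m k))))
    Z-step : inv (nq ((suc m ∸ k) !)) * (M + 1ℚ - K) ≡ inv (nq ((m ∸ k) !))
    Z-step = trans (cong (inv (nq ((suc m ∸ k) !)) *_)
                         (sym (trans (nq-∸ (ℕ.m≤n⇒m≤1+n k≤m)) (cong (_- K) (nq-suc m)))))
                   (inv-nq-!-step (ℕ.+-∸-assoc 1 k≤m))

  certificate : ∀ n → 1 ≤ n → 1 ≤ i → X n * fac t i n + D * fac t n n ≡ fac t k n * E n
  certificate n 1≤n 1≤i = begin
    X n * fac t i n + D * fac t n n
      ≡⟨ cong₂ (λ x y → X n * x + D * y) (fac-polynomial t {i} n 1≤i) (fac-polynomial t {n} n 1≤n) ⟩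
    _ ≡⟨ gosper-certificate (t * t) I K (nq n) ⟩
    _ ≡⟨ cong (_* E n) (sym (fac-polynomial t {k} n (s≤s z≤n))) ⟩
    fac t k n * E n ∎

  gosper-step : ∀ m → k ≤ suc m → suc m ≤ i →
                P i m * (D * T m) ≡ P k m * (C (suc m) * X (suc m)) → Telescoped (suc m)
  gosper-step m k≤n n≤i ih = begin
    P i m * fᵢ * (D * (T m + F n))
      ≡⟨ distribute (P i m) fᵢ D (T m) (F n) ⟩
    fᵢ * (P i m * (D * T m)) + D * (P i n * F n)
      ≡⟨ cong₂ (λ x y → fᵢ * x + D * y) ih (summand m k≤n n≤i) ⟩
    fᵢ * (P k m * (C n * X n)) + D * (fₙ * P k m * C n)
      ≡⟨ factor fᵢ (P k m) (C n) (X n) D fₙ ⟩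
    P k m * C n * (X n * fᵢ + D * fₙ)
      ≡⟨ cong (P k m * C n *_) (certificate n (s≤s z≤n) (ℕ.≤-trans (s≤s z≤n) n≤i)) ⟩
    P k m * C n * (fac t k n * E n)
      ≡⟨ regroup (P k m) (C n) (fac t k n) (E n) ⟩
    P k m * fac t k n * (C n * E n) ∎
    where
    n : ℕ
    n = suc m
    fᵢ fₙ : ℚ
    fᵢ = fac t i n
    fₙ = fac t n n
    distribute : ∀ p f d x y → p * f * (d * (x + y)) ≡ f * (p * (d * x)) + d * (p * f * y)
    distribute = solve-∀ ℚ-ring
    factor : ∀ f p c x d g → f * (p * (c * x)) + d * (g * p * c) ≡ p * c * (x * f + d * g)
    factor = solve-∀ ℚ-ring
    regroup : ∀ p c f e → p * c * (f * e) ≡ p * f * (c * e)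
    regroup = solve-∀ ℚ-ring

  telescope : ∀ d → d ℕ.+ k ≤ i → Telescoped (d ℕ.+ k)
  telescope zero    k≤i = gosper-step k′ ℕ.≤-refl k≤i (begin
    P i k′ * (D * T k′)   ≡⟨ cong (λ x → P i k′ * (D * x)) (n<k⇒T[n]≡0 k′ ℕ.≤-refl) ⟩
    P i k′ * (D * 0ℚ)     ≡⟨ both-vanish (P i k′) D (P k k′) (C k) K ⟩
    P k k′ * (C k * X k)  ∎)
    where
    both-vanish : ∀ p d q c x → p * (d * 0ℚ) ≡ q * (c * ((x - x) * (x + x - 1ℚ)))
    both-vanish = solve-∀ ℚ-ring
  telescope (suc d) n≤i = gosper-step m (ℕ.m≤n⇒m≤1+n k≤m) n≤i
    (trans (telescope d (ℕ.≤-trans (ℕ.n≤1+n m) n≤i)) (cong (P k m *_) (C-recurrence m k≤m n≤i)))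
    where
    m : ℕ
    m = d ℕ.+ k
    k≤m : k ≤ m
    k≤m = ℕ.m≤n+m k d

  k<i⇒T[i]≡0 : k < i → T i ≡ 0ℚ
  k<i⇒T[i]≡0 k<i = *-cancelˡ-≡0 (D≢0 k<i) (*-cancelˡ-≡0 (P≢0 i 1≤i) (begin
    P i i * (D * T i)    ≡⟨ subst Telescoped d+k≡i (telescope d (ℕ.≤-reflexive d+k≡i)) ⟩
    P k i * (C i * E i)  ≡⟨ E-vanishes (P k i) (C i) I ⟩
    0ℚ                   ∎))
    where
    d : ℕ
    d = i ∸ k
    d+k≡i : d ℕ.+ k ≡ i
    d+k≡i = ℕ.m∸n+n≡m (ℕ.<⇒≤ k<i)
    1≤i : 1 ≤ i
    1≤i = ℕ.≤-trans (s≤s z≤n) (ℕ.<⇒≤ k<i)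
    E-vanishes : ∀ p c x → p * (c * ((x - x) * (x + x - 1ℚ))) ≡ 0ℚ
    E-vanishes = solve-∀ ℚ-ring

mainTheorem2 : (t : ℚ)
    → (∀ a b → 1 ≤ a → 1 ≤ b → fac t a b ≢ 0ℚ)
    → (s : ℕ) → (i k : ℕ) → 1 ≤ i → i ≤ s → 1 ≤ k → k ≤ s
    → sum1 s (λ j → L t i j * Lt t j k) ≡ δ i k
mainTheorem2 t fac≢0 s i (suc k′) _ i≤s _ _ = begin
  sum1 s F
    ≡⟨ sum1-tail s F i≤s (λ j i<j → trans (cong (_* Lt t j k) (L-upper≡0 i<j)) (ℚ.*-zeroˡ (Lt t j k))) ⟩
  T i
    ≡⟨ by-trichotomy (ℕ.<-cmp i k) ⟩
  δ i k ∎
  where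
  open ProductEntry t fac≢0 i k′
  by-trichotomy : Tri (i < k) (i ≡ k) (k < i) → T i ≡ δ i k
  by-trichotomy (tri< i<k i≢k _) = trans (n<k⇒T[n]≡0 i i<k) (sym (δ-≢ i≢k))
  by-trichotomy (tri≈ _ refl _)  = begin
    T k′ + L t k k * Lt t k k
      ≡⟨ cong₂ _+_ (n<k⇒T[n]≡0 k′ ℕ.≤-refl)
                   (cong₂ _*_ (L-diagonal {t} {k} (P≢0 {k} k (s≤s z≤n)))
                              (Lt-diagonal {t} k′ (P≢0 {k} k′ (s≤s z≤n)))) ⟩
    0ℚ + 1ℚ * 1ℚ
      ≡⟨ sym (δ-refl k) ⟩
    δ k k ∎
  by-trichotomy (tri> _ i≢k k<i) = trans (k<i⇒T[i]≡0 k<i) (sym (δ-≢ i≢k))
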